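{- Let $(D,I,R)$ be a right and $(D,J,R)$ a left string data structure over $[n]$ such that $I$ and $J$ commute. Let $(D',I',R')$ be a right and $(D',J',R')$ a left string data structure over $[n]$. Suppose there is a surjective map $f:D\to D'$ which is a morphism of right string data structures from $(D,I,R)$ to $(D',I',R')$ and a morphism of left string data structures from $(D,J,R)$ to $(D',J',R')$. Then $I'$ and $J'$ commute.
   Context: Fix $n\geq1$ and $[n]=\{1<\dots<n\}$; $[n]^\ast$ is the free monoid with empty word $\lambda$. For a nonempty word $u$, $\ell(u)$ is its leftmost letter, $\mathrm{rem}(u)$ the word with $u=\ell(u)\mathrm{rem}(u)$, and $\underline{u}$ the mirror (reversed) word. A right string data structure $(D,I,R)$: a set $D$ with distinguished element $\emptyset$, maps $R:D\to[n]^\ast$, $I:D\times[n]\to D$ with (i) $R(I(\emptyset,x))=x$ for $x\in[n]$; (ii) $\emptyset\leftarrow_I R(d)=d$ for all $d$, where $d\leftarrow_I\lambda=d$ and $d\leftarrow_I u=I(d,\ell(u))\leftarrow_I\mathrm{rem}(u)$; (iii) $R$ injective with $R(\emptyset)=\lambda$. A left string data structure $(D,J,R)$ satisfies the same conditions except that (ii) is replaced by $R(d)\rightarrow_J\emptyset=d$, where $\rightarrow_J:[n]^\ast\times D\to D$ is given by $\lambda\rightarrow_J d=d$ and $u\rightarrow_J d=\underline{\mathrm{rem}(\underline{u})}\rightarrow_J J(d,\ell(\underline{u}))$ (letters of $u$ are inserted from right to left). Constructors: $C(w)=\emptyset\leftarrow_I w$ for right ones and $C(w)=w\rightarrow_J\emptyset$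 for left ones. The insertions $I$ and $J$ on the same set $D$ commute if $y\rightarrow_J(d\leftarrow_I x)=(y\rightarrow_J d)\leftarrow_I x$ for all $d\in D$ and $x,y\in[n]$. A morphism of right string data structures $(D,I,R)\to(D',I',R')$ is a map $f:D\to D'$ with $f(\emptyset)=\emptyset'$, $f(d\leftarrow_I x)=f(d)\leftarrow_{I'}x$ for all $d,x$, and $C_{(D',I',R')}(R(d))=C_{(D',I',R')}(R'(f(d)))$ for all $d$. A morphism of left string data structures $(D,J,R)\to(D',J',R')$ is defined the same way with the condition $f(x\rightarrow_J d)=x\rightarrow_{J'}f(d)$ and the left constructors. -}

module Defs where

open import Data.Nat using (ℕ)
open import Data.Fin using (Fin)
open import Data.List using (List; []; _∷_; [_]; foldl; foldr)
open import Relation.Binary.PropositionalEquality using (_≡_)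
open import Function.Definitions using (Injective; Surjective)

-- Words over [n] = {1 < ... < n} are lists over Fin n (Fin n ≅ [n], order preserved).
Word : ℕ → Set
Word n = List (Fin n)

insR : ∀ {n} {D : Set} → (D → Fin n → D) → D → Word n → D
insR I d u = foldl I d u

insL : ∀ {n} {D : Set} → (D → Fin n → D) → Word n → D → D
insL J u d = foldr (λ x acc → J acc x) d u

record RightSDS (n : ℕ) (D : Set) (∅ : D) (I : D → Fin n → D) (R : D → Word n) : Set where
  field
    R-single : ∀ (x : Fin n) → R (I ∅ x) ≡ [ x ]
    R-recon  : ∀ (d : D) → insR I ∅ (R d) ≡ d
    R-inj    : Injective _≡_ _≡_ R
    R-empty  : R ∅ ≡ []

record LeftSDS (n : ℕ) (D : Set) (∅ : D) (J : D → Fin n → D) (R : D → Word n) : Set where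
  field
    R-single : ∀ (x : Fin n) → R (J ∅ x) ≡ [ x ]
    R-recon  : ∀ (d : D) → insL J (R d) ∅ ≡ d
    R-inj    : Injective _≡_ _≡_ R
    R-empty  : R ∅ ≡ []

Commute : ∀ {n} {D : Set} → (D → Fin n → D) → (D → Fin n → D) → Set
Commute {n} {D} I J =
  ∀ (d : D) (x y : Fin n) → insL J [ y ] (insR I d [ x ]) ≡ insR I (insL J [ y ] d) [ x ]

record IsRightMorphism {n} {D D' : Set} (∅ : D) (∅' : D')
    (I : D → Fin n → D) (R : D → Word n)
    (I' : D' → Fin n → D') (R' : D' → Word n) (f : D → D') : Set where
  field
    pres-∅   : f ∅ ≡ ∅'
    pres-ins : ∀ (d : D) (x : Fin n) → f (insR I d [ x ]) ≡ insR I' (f d) [ x ]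
    pres-C   : ∀ (d : D) → insR I' ∅' (R d) ≡ insR I' ∅' (R' (f d))

record IsLeftMorphism {n} {D D' : Set} (∅ : D) (∅' : D')
    (J : D → Fin n → D) (R : D → Word n)
    (J' : D' → Fin n → D') (R' : D' → Word n) (f : D → D') : Set where
  field
    pres-∅   : f ∅ ≡ ∅'
    pres-ins : ∀ (d : D) (x : Fin n) → f (insL J [ x ] d) ≡ insL J' [ x ] (f d)
    pres-C   : ∀ (d : D) → insL J' (R d) ∅' ≡ insL J' (R' (f d)) ∅'

module Submission where

open import Defs
open import Data.Nat using (ℕ; NonZero)
open import Data.Fin using (Fin)
open import Data.List using ([_])
open import Data.Product using (_,_)
open import Relation.Binary.PropositionalEquality using (_≡_; refl; sym; cong; module ≡-Reasoning)
open import Function.Definitions using (Surjective)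

Commute-transport : ∀ {n} {D D' : Set}
  (I J : D → Fin n → D) (I' J' : D' → Fin n → D') (f : D → D') →
  Surjective _≡_ _≡_ f →
  (∀ d x → f (insR I d [ x ]) ≡ insR I' (f d) [ x ]) →
  (∀ d y → f (insL J [ y ] d) ≡ insL J' [ y ] (f d)) →
  Commute I J → Commute I' J'
Commute-transport I J I' J' f surj f-I f-J comm d' x y
  with surj d'
... | d , f-section with f-section refl
... | refl = begin
    J' (I' (f d) x) y  ≡⟨ cong (λ e → J' e y) (sym (f-I d x)) ⟩
    J' (f (I d x)) y   ≡⟨ sym (f-J (I d x) y) ⟩
    f (J (I d x) y)    ≡⟨ cong f (comm d x y) ⟩
    f (I (J d y) x)    ≡⟨ f-I (J d y) x ⟩
    I' (f (J d y)) x   ≡⟨ cong (λ e → I' e x) (f-J d y) ⟩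
    I' (J' (f d) y) x  ∎
  where open ≡-Reasoning

lemma2p1p4 : (n : ℕ) → .{{_ : NonZero n}} →
    {D : Set} (∅ : D) (I J : D → Fin n → D) (R : D → Word n) →
    {D' : Set} (∅' : D') (I' J' : D' → Fin n → D') (R' : D' → Word n) →
    RightSDS n D ∅ I R → LeftSDS n D ∅ J R →
    Commute I J →
    RightSDS n D' ∅' I' R' → LeftSDS n D' ∅' J' R' →
    (f : D → D') → Surjective _≡_ _≡_ f →
    IsRightMorphism ∅ ∅' I R I' R' f →
    IsLeftMorphism ∅ ∅' J R J' R' f →
    Commute I' J'
lemma2p1p4 n ∅ I J R ∅' I' J' R' _ _ comm _ _ f surj right-mor left-mor =
  Commute-transport I J I' J' f surj
    (IsRightMorphism.pres-ins right-mor) (IsLeftMorphism.pres-ins left-mor) comm
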